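{- If $q$ is a pattern containing the pattern $201$, then $\mathcal{A}_{101,q}(n)=\mathcal{A}_{101}(n)$ for every $n\ge 1$.
   Context: An ascent of an integer word $x_1\cdots x_n$ is an index $j$ with $x_j<x_{j+1}$; $\mathrm{asc}(x_1\cdots x_n)$ denotes the number of ascents. An ascent sequence of length $n$ is a sequence $x_1\cdots x_n$ of nonnegative integers with $x_1=0$ and $x_i\le \mathrm{asc}(x_1\cdots x_{i-1})+1$ for all $1<i\le n$. A pattern is a word $p=p_1\cdots p_k$ of nonnegative integers whose set of values is $\{0,1,\dots,m\}$ for some $m$. A word $x_1\cdots x_n$ contains $p$ if there are indices $i_1<\cdots<i_k$ such that $x_{i_1}\cdots x_{i_k}$ is order-isomorphic to $p$ (i.e. for all $s,t$, $x_{i_s}<x_{i_t}$ iff $p_s<p_t$ and $x_{i_s}=x_{i_t}$ iff $p_s=p_t$); otherwise it avoids $p$. A pattern $q$ contains a pattern $p$ in the same sense. For a list $B$ of patterns, $\mathcal{A}_B(n)$ is the set of ascent sequences of length $n$ avoiding every pattern in $B$. -}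

module Defs where

open import Data.Nat using (ℕ; zero; suc; _<_; _≤_; _+_; _<?_)
open import Data.Unit using (⊤)
open import Relation.Nullary using (yes; no)
open import Data.List using (List; []; _∷_; length; lookup; _++_; [_])
open import Data.List.Relation.Binary.Sublist.Propositional using (_⊆_)
open import Data.List.Membership.Propositional using (_∈_)
open import Data.Fin using (Fin; cast)
open import Data.Product using (Σ; _×_; ∃-syntax)
open import Function.Bundles using (_⇔_)
open import Relation.Binary.PropositionalEquality using (_≡_)
open import Relation.Nullary using (¬_)

Word : Set
Word = List ℕ

ascInd : ℕ → ℕ → ℕ
ascInd x y with x <? y
... | yes _ = 1
... | no _ = 0

asc : Word → ℕ
asc [] = 0
asc (x ∷ []) = 0
asc (x ∷ y ∷ w) = ascInd x y + asc (y ∷ w)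

-- x₁ = 0 and x_i ≤ asc(x₁⋯x_{i-1}) + 1 for all 1 < i ≤ n
-- (checked on a word given by its prefix, processed from the left)
AscSeqFrom : Word → Word → Set
AscSeqFrom pre [] = ⊤
AscSeqFrom pre (x ∷ w) = x ≤ suc (asc pre) × AscSeqFrom (pre ++ [ x ]) w

IsAscentSequence : Word → Set
IsAscentSequence [] = ⊤
IsAscentSequence (x ∷ w) = x ≡ 0 × AscSeqFrom [ x ] w

IsPattern : Word → Set
IsPattern p = ∃[ m ] (∀ v → (v ∈ p ⇔ v ≤ m))

OrderIso : Word → Word → Set
OrderIso u p = Σ (length u ≡ length p) λ eq →
  ∀ (s t : Fin (length u)) →
    ((lookup u s < lookup u t) ⇔ (lookup p (cast eq s) < lookup p (cast eq t)))
    × ((lookup u s ≡ lookup u t) ⇔ (lookup p (cast eq s) ≡ lookup p (cast eq t)))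

Contains : Word → Word → Set
Contains w p = ∃[ u ] (u ⊆ w × OrderIso u p)

Avoids : Word → Word → Set
Avoids w p = ¬ Contains w p

InA : List Word → ℕ → Word → Set
InA B n x = IsAscentSequence x × length x ≡ n × (∀ p → p ∈ B → Avoids x p)

-- In a 101-avoiding ascent sequence every prefix has value set exactly
-- {0, …, asc(prefix)}: a new entry x ≤ asc + 1 that creates an ascent from the
-- last entry y < x cannot be an old value, since x ⋯ y x would be an occurrence
-- of 101, so it is the new maximum asc + 1. Consequently every value below an
-- entry already occurs before it, and an occurrence a b c of 201 (b < c < a)
-- yields an occurrence c ⋯ b c of 101. So a 101-avoiding ascent sequence avoids
-- 201, hence every pattern containing 201.
module Submission where

open import Defs
open import Data.Nat using (ℕ; zero; suc; _≤_; _<_; _+_; _<?_; z≤n; s≤s)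
open import Data.Nat.Properties
  using (<-irrefl; <-asym; <⇒≢; >⇒≢; ≤-trans; ≤-antisym; ≤-pred; ≰⇒>; n≮0;
         m≤n⇒m<n∨m≡n; +-identityʳ; +-assoc; +-comm)
open import Data.List using (List; []; _∷_; length; lookup; drop; _++_; [_])
open import Data.List.Properties using (++-assoc)
open import Data.List.Relation.Binary.Sublist.Propositional
  using (_⊆_; []; _∷_; _∷ʳ_; ⊆-refl; ⊆-trans; minimum; from∈)
open import Data.List.Relation.Binary.Sublist.Propositional.Properties using (++⁺)
open import Data.List.Relation.Unary.Any using (here; there)
open import Data.List.Membership.Propositional using (_∈_)
open import Data.List.Membership.Propositional.Properties using (∈-++⁺ˡ; ∈-++⁺ʳ; ∈-++⁻)
open import Data.Fin as Fin using (Fin; toℕ; cast)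
open import Data.Fin.Properties using (toℕ-cast; cast-involutive)
open import Data.Product using (Σ-syntax; ∃-syntax; _×_; _,_; proj₁)
open import Data.Sum using (inj₁; inj₂)
open import Data.Empty using (⊥-elim)
open import Function using (_∘_)
open import Function.Bundles using (_⇔_; mk⇔; Equivalence)
open import Relation.Binary.PropositionalEquality
  using (_≡_; _≢_; refl; sym; trans; cong; subst; subst₂)
open import Relation.Nullary using (¬_; yes; no)

pattern101 pattern201 : Word
pattern101 = 1 ∷ 0 ∷ 1 ∷ []
pattern201 = 2 ∷ 0 ∷ 1 ∷ []

Occurrence101 : Word → Set
Occurrence101 w = ∃[ a ] ∃[ b ] (b < a × a ∷ b ∷ a ∷ [] ⊆ w)

Occurrence201 : Word → Set
Occurrence201 w = ∃[ a ] ∃[ b ] ∃[ c ] (a ∷ b ∷ c ∷ [] ⊆ w × b < c × c < a)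

Positions201 : Word → Set
Positions201 w = Σ[ i ∈ Fin (length w) ] Σ[ j ∈ Fin (length w) ] Σ[ k ∈ Fin (length w) ]
  (i Fin.< j × j Fin.< k × lookup w j < lookup w k × lookup w k < lookup w i)

∷⊆drop⇒lookup : ∀ (xs : Word) d {y ys} → y ∷ ys ⊆ drop d xs →
  Σ[ i ∈ Fin (length xs) ] (d ≤ toℕ i × lookup xs i ≡ y × ys ⊆ drop (suc (toℕ i)) xs)
∷⊆drop⇒lookup []       zero    ()
∷⊆drop⇒lookup []       (suc d) ()
∷⊆drop⇒lookup (x ∷ xs) zero    (x≡y ∷ ys⊆xs) = Fin.zero , z≤n , sym x≡y , ys⊆xs
∷⊆drop⇒lookup (x ∷ xs) zero    (.x ∷ʳ p) =
  let i , _ , xᵢ≡y , ys⊆ = ∷⊆drop⇒lookup xs zero p in Fin.suc i , z≤n , xᵢ≡y , ys⊆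
∷⊆drop⇒lookup (x ∷ xs) (suc d) p =
  let i , d≤i , xᵢ≡y , ys⊆ = ∷⊆drop⇒lookup xs d p in Fin.suc i , s≤s d≤i , xᵢ≡y , ys⊆

lookup∷⊆drop : ∀ (xs : Word) {d} (i : Fin (length xs)) {ys} → d ≤ toℕ i →
  ys ⊆ drop (suc (toℕ i)) xs → lookup xs i ∷ ys ⊆ drop d xs
lookup∷⊆drop (x ∷ xs) {zero}  Fin.zero    _         ys⊆ = refl ∷ ys⊆
lookup∷⊆drop (x ∷ xs) {zero}  (Fin.suc i) _         ys⊆ = x ∷ʳ lookup∷⊆drop xs i z≤n ys⊆
lookup∷⊆drop (x ∷ xs) {suc d} (Fin.suc i) (s≤s d≤i) ys⊆ = lookup∷⊆drop xs i d≤i ys⊆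

occurrence201⇒positions201 : ∀ {w} → Occurrence201 w → Positions201 w
occurrence201⇒positions201 {w} (a , b , c , abc⊆w , b<c , c<a)
  with i , _   , refl , bc⊆ ← ∷⊆drop⇒lookup w 0 abc⊆w
  with j , i<j , refl , c⊆  ← ∷⊆drop⇒lookup w (suc (toℕ i)) bc⊆
  with k , j<k , refl , _   ← ∷⊆drop⇒lookup w (suc (toℕ j)) c⊆
  = i , j , k , i<j , j<k , b<c , c<a

positions201⇒occurrence201 : ∀ {w} → Positions201 w → Occurrence201 w
positions201⇒occurrence201 {w} (i , j , k , i<j , j<k , wⱼ<wₖ , wₖ<wᵢ) =
  lookup w i , lookup w j , lookup w k ,
  lookup∷⊆drop w i z≤n (lookup∷⊆drop w j i<j (lookup∷⊆drop w k j<k (minimum _))) ,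
  wⱼ<wₖ , wₖ<wᵢ

positions201-orderIso : ∀ {u p} → OrderIso u p → Positions201 p → Positions201 u
positions201-orderIso {u} {p} (eq , iso) (i , j , k , i<j , j<k , pⱼ<pₖ , pₖ<pᵢ) =
  ι i , ι j , ι k , ι-mono i<j , ι-mono j<k , reflect-< pⱼ<pₖ , reflect-< pₖ<pᵢ
  where
  ι : Fin (length p) → Fin (length u)
  ι = cast (sym eq)
  ι-mono : ∀ {m n} → m Fin.< n → ι m Fin.< ι n
  ι-mono {m} {n} = subst₂ _<_ (sym (toℕ-cast (sym eq) m)) (sym (toℕ-cast (sym eq) n))
  reflect-< : ∀ {m n} → lookup p m < lookup p n → lookup u (ι m) < lookup u (ι n)
  reflect-< {m} {n} pₘ<pₙ = Equivalence.from (proj₁ (iso (ι m) (ι n)))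
    (subst₂ (λ m′ n′ → lookup p m′ < lookup p n′)
      (sym (cast-involutive eq (sym eq) m)) (sym (cast-involutive eq (sym eq) n)) pₘ<pₙ)

occurrence201-⊆ : ∀ {u w} → u ⊆ w → Occurrence201 u → Occurrence201 w
occurrence201-⊆ u⊆w (a , b , c , abc⊆u , b<c , c<a) = a , b , c , ⊆-trans abc⊆u u⊆w , b<c , c<a

contains201⇒occurrence201 : ∀ {w} → Contains w pattern201 → Occurrence201 w
contains201⇒occurrence201 ((a ∷ b ∷ c ∷ []) , abc⊆w , refl , iso) =
  a , b , c , abc⊆w ,
  Equivalence.from (proj₁ (iso (Fin.suc Fin.zero) (Fin.suc (Fin.suc Fin.zero)))) (s≤s z≤n) ,
  Equivalence.from (proj₁ (iso (Fin.suc (Fin.suc Fin.zero)) Fin.zero)) (s≤s (s≤s z≤n))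

occurrence201-contains : ∀ {w q} → Occurrence201 q → Contains w q → Occurrence201 w
occurrence201-contains {q = q} occ (u , u⊆w , u≅q) =
  occurrence201-⊆ u⊆w
    (positions201⇒occurrence201 (positions201-orderIso {u} {q} u≅q (occurrence201⇒positions201 occ)))

orderIso-101 : ∀ {a b} → b < a → OrderIso (a ∷ b ∷ a ∷ []) pattern101
orderIso-101 {a} {b} b<a = refl , compare
  where
  ⇔-false : {P Q : Set} → ¬ P → ¬ Q → P ⇔ Q
  ⇔-false ¬p ¬q = mk⇔ (⊥-elim ∘ ¬p) (⊥-elim ∘ ¬q)
  ⇔-true : {P Q : Set} → P → Q → P ⇔ Q
  ⇔-true p q = mk⇔ (λ _ → q) (λ _ → p)
  same : ∀ {m k : ℕ} → ((m < m) ⇔ (k < k)) × ((m ≡ m) ⇔ (k ≡ k))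
  same = ⇔-false (<-irrefl refl) (<-irrefl refl) , ⇔-true refl refl
  high-low : ((a < b) ⇔ (1 < 0)) × ((a ≡ b) ⇔ (1 ≡ 0))
  high-low = ⇔-false (<-asym b<a) n≮0 , ⇔-false (>⇒≢ b<a) λ ()
  low-high : ((b < a) ⇔ (0 < 1)) × ((b ≡ a) ⇔ (0 ≡ 1))
  low-high = ⇔-true b<a (s≤s z≤n) , ⇔-false (<⇒≢ b<a) λ ()
  aba : Word
  aba = a ∷ b ∷ a ∷ []
  compare : ∀ (s t : Fin 3) →
    ((lookup aba s < lookup aba t) ⇔ (lookup pattern101 (cast refl s) < lookup pattern101 (cast refl t)))
    × ((lookup aba s ≡ lookup aba t) ⇔ (lookup pattern101 (cast refl s) ≡ lookup pattern101 (cast refl t)))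
  compare Fin.zero                     Fin.zero                     = same
  compare Fin.zero                     (Fin.suc Fin.zero)           = high-low
  compare Fin.zero                     (Fin.suc (Fin.suc Fin.zero)) = same
  compare (Fin.suc Fin.zero)           Fin.zero                     = low-high
  compare (Fin.suc Fin.zero)           (Fin.suc Fin.zero)           = same
  compare (Fin.suc Fin.zero)           (Fin.suc (Fin.suc Fin.zero)) = low-high
  compare (Fin.suc (Fin.suc Fin.zero)) Fin.zero                     = same
  compare (Fin.suc (Fin.suc Fin.zero)) (Fin.suc Fin.zero)           = high-low
  compare (Fin.suc (Fin.suc Fin.zero)) (Fin.suc (Fin.suc Fin.zero)) = same

occurrence101⇒contains101 : ∀ {w} → Occurrence101 w → Contains w pattern101
occurrence101⇒contains101 (a , b , b<a , aba⊆w) = a ∷ b ∷ a ∷ [] , aba⊆w , orderIso-101 b<a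

occurrence101-⊆ : ∀ {u w} → u ⊆ w → Occurrence101 u → Occurrence101 w
occurrence101-⊆ u⊆w (a , b , b<a , aba⊆u) = a , b , b<a , ⊆-trans aba⊆u u⊆w

lastOf : ℕ → List ℕ → ℕ
lastOf y []       = y
lastOf y (z ∷ zs) = lastOf z zs

lastOf∈ : ∀ y ys → lastOf y ys ∈ y ∷ ys
lastOf∈ y []       = here refl
lastOf∈ y (z ∷ zs) = there (lastOf∈ z zs)

∈⇒∷lastOf⊆ : ∀ {x} y ys → x ∈ y ∷ ys → x ≢ lastOf y ys → x ∷ lastOf y ys ∷ [] ⊆ y ∷ ys
∈⇒∷lastOf⊆ y []       (here x≡y) x≢last = ⊥-elim (x≢last x≡y)
∈⇒∷lastOf⊆ y (z ∷ zs) (here x≡y) _      = x≡y ∷ from∈ (lastOf∈ z zs)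
∈⇒∷lastOf⊆ y (z ∷ zs) (there x∈) x≢last = y ∷ʳ ∈⇒∷lastOf⊆ z zs x∈ x≢last

asc-∷ʳ : ∀ y ys x → asc (y ∷ ys ++ [ x ]) ≡ asc (y ∷ ys) + ascInd (lastOf y ys) x
asc-∷ʳ y []       x = +-identityʳ (ascInd y x)
asc-∷ʳ y (z ∷ zs) x =
  trans (cong (ascInd y z +_) (asc-∷ʳ z zs x)) (sym (+-assoc (ascInd y z) (asc (z ∷ zs)) _))

DownClosed : Word → Set
DownClosed w = ∀ {v c} → v ∈ w → c ≤ v → c ∈ w

-- With DownClosed, asc w ∈ w says that every value in {0, …, asc w} occurs in w.
Saturated : Word → Set
Saturated w = DownClosed w × asc w ∈ w

saturated-below-entry : ∀ {w x c} → Saturated w → x ≤ suc (asc w) → c < x → c ∈ w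
saturated-below-entry (closed , asc∈) x≤ c<x = closed asc∈ (≤-pred (≤-trans c<x x≤))

downClosed-∷ʳ : ∀ {w x} → Saturated w → x ≤ suc (asc w) → DownClosed (w ++ [ x ])
downClosed-∷ʳ {w} sat x≤ v∈ c≤v with ∈-++⁻ w v∈
... | inj₁ v∈w          = ∈-++⁺ˡ (proj₁ sat v∈w c≤v)
... | inj₂ (here refl) with m≤n⇒m<n∨m≡n c≤v
...   | inj₁ c<x  = ∈-++⁺ˡ (saturated-below-entry sat x≤ c<x)
...   | inj₂ refl = ∈-++⁺ʳ w (here refl)

asc∈-∷ʳ : ∀ y ys x → Saturated (y ∷ ys) → x ≤ suc (asc (y ∷ ys)) →
  ¬ Occurrence101 (y ∷ ys ++ [ x ]) → asc (y ∷ ys ++ [ x ]) ∈ y ∷ ys ++ [ x ]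
asc∈-∷ʳ y ys x (closed , asc∈) x≤ no101 rewrite asc-∷ʳ y ys x with lastOf y ys <? x
... | no _ rewrite +-identityʳ (asc (y ∷ ys)) = ∈-++⁺ˡ asc∈
... | yes last<x =
  subst (_∈ y ∷ ys ++ [ x ]) (trans x≡1+asc (+-comm 1 _)) (∈-++⁺ʳ (y ∷ ys) (here refl))
  where
  x≰asc : ¬ (x ≤ asc (y ∷ ys))
  x≰asc x≤asc = no101 (x , lastOf y ys , last<x ,
    ++⁺ (∈⇒∷lastOf⊆ y ys (closed asc∈ x≤asc) (>⇒≢ last<x)) (refl ∷ []))
  x≡1+asc : x ≡ suc (asc (y ∷ ys))
  x≡1+asc = ≤-antisym x≤ (≰⇒> x≰asc)

ascSeqFrom-no201 : ∀ y ys w → Saturated (y ∷ ys) → AscSeqFrom (y ∷ ys) w →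
  ¬ Occurrence101 (y ∷ ys ++ w) → ¬ Occurrence201 w
ascSeqFrom-no201 y ys (x ∷ w) sat (x≤ , rest) no101 (a , b , c , x ∷ʳ abc⊆ , b<c , c<a) =
  ascSeqFrom-no201 y (ys ++ [ x ]) w (downClosed-∷ʳ sat x≤ , asc∈) rest no101′
    (a , b , c , abc⊆ , b<c , c<a)
  where
  no101′ : ¬ Occurrence101 (y ∷ (ys ++ [ x ]) ++ w)
  no101′ rewrite ++-assoc (y ∷ ys) [ x ] w = no101
  asc∈ : asc (y ∷ ys ++ [ x ]) ∈ y ∷ ys ++ [ x ]
  asc∈ = asc∈-∷ʳ y ys x sat x≤
    (no101 ∘ occurrence101-⊆ (++⁺ (⊆-refl {x = y ∷ ys}) (refl ∷ minimum w)))
ascSeqFrom-no201 y ys (x ∷ w) sat (x≤ , _) no101 (a , b , c , refl ∷ bc⊆ , b<c , c<a) =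
  no101 (c , b , b<c , ++⁺ (from∈ (saturated-below-entry sat x≤ c<a)) (x ∷ʳ bc⊆))

ascentSequence-no101⇒no201 : ∀ {w} → IsAscentSequence w → ¬ Occurrence101 w → ¬ Occurrence201 w
ascentSequence-no101⇒no201 {0 ∷ w} _ _ (_ , _ , _ , refl ∷ _ , _ , c<0) = n≮0 c<0
ascentSequence-no101⇒no201 {0 ∷ w} (refl , rest) no101 (a , b , c , 0 ∷ʳ abc⊆ , b<c , c<a) =
  ascSeqFrom-no201 0 [] w (closed , here refl) rest no101 (a , b , c , abc⊆ , b<c , c<a)
  where
  closed : DownClosed [ 0 ]
  closed (here refl) z≤n = here refl

ascentSequence-avoids101⇒avoids : ∀ {w q} → IsAscentSequence w → Avoids w pattern101 →
  Contains q pattern201 → Avoids w q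
ascentSequence-avoids101⇒avoids isAsc w∌101 q∋201 w∋q =
  ascentSequence-no101⇒no201 isAsc (w∌101 ∘ occurrence101⇒contains101)
    (occurrence201-contains (contains201⇒occurrence201 q∋201) w∋q)

corollary2p4 : (q : Word) → IsPattern q → Contains q (2 ∷ 0 ∷ 1 ∷ []) →
    (n : ℕ) → 1 ≤ n →
    (x : Word) → InA ((1 ∷ 0 ∷ 1 ∷ []) ∷ q ∷ []) n x ⇔ InA ((1 ∷ 0 ∷ 1 ∷ []) ∷ []) n x
corollary2p4 q _ q∋201 n _ x = mk⇔
  (λ (isAsc , len , avoids) → isAsc , len , λ { _ (here refl) → avoids _ (here refl) })
  (λ (isAsc , len , avoids) → isAsc , len , λ where
    _ (here refl)         → avoids _ (here refl)
    _ (there (here refl)) → ascentSequence-avoids101⇒avoids isAsc (avoids _ (here refl)) q∋201)
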